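{- Let $M$ be a round matroid. Then $\operatorname{tw}(M)=r(M)$.
   Context: A vertical cover of a matroid $M$ is a pair $(F,F')$ of flats, neither equal to $E(M)$, with $F\cup F'=E(M)$; $M$ is round if it has no vertical cover. A tree-decomposition of $M$ is a pair $(T,\tau)$ with $T$ a tree and $\tau:V(T)\to\mathcal{P}(E(M))$ such that every element of $E(M)$ lies in $\tau(t)$ for at least one node $t$. For a node $t$ with $T-t$ having components $T_1,\dots,T_d$ and $F_i=\bigcup_{s\in V(T_i)}\tau(s)$, the node-width of $t$ is $\sum_{i=1}^{d} r\big(\tau(t)\cup\bigcup_{k\neq i}F_k\big)-(d-1)r(M)$; the width of $(T,\tau)$ is the maximum node-width over its nodes, and the tree-width $\operatorname{tw}(M)$ is the minimum width over all tree-decompositions of $M$. -}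

module Defs where

open import Data.Nat as ℕ using (ℕ; zero; suc)
open import Data.Integer as ℤ using (ℤ; +_)
open import Data.Fin using (Fin)
open import Data.Fin.Subset using (Subset; _∈_; _∉_; _⊆_; _∪_; _∩_; ⁅_⁆; ⊤; ⊥; ∣_∣)
open import Data.List using (List; []; _∷_; _++_; length)
open import Data.List.Relation.Unary.All using (All)
open import Data.List.Relation.Unary.Any using (Any)
open import Data.Maybe using (Maybe; just; nothing)
open import Data.Product using (Σ; _×_; _,_; ∃)
open import Relation.Binary.PropositionalEquality using (_≡_; _≢_)
open import Relation.Nullary using (¬_)

record Matroid (n : ℕ) : Set where
  field
    r          : Subset n → ℕ
    r-bounded  : ∀ X → r X ℕ.≤ ∣ X ∣
    r-mono     : ∀ {X Y} → X ⊆ Y → r X ℕ.≤ r Y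
    r-submod   : ∀ X Y → r (X ∪ Y) ℕ.+ r (X ∩ Y) ℕ.≤ r X ℕ.+ r Y

open Matroid public

rank : ∀ {n} → Matroid n → ℕ
rank M = r M ⊤

IsFlat : ∀ {n} → Matroid n → Subset n → Set
IsFlat M F = ∀ e → e ∉ F → r M F ℕ.< r M (F ∪ ⁅ e ⁆)

IsVerticalCover : ∀ {n} → Matroid n → Subset n → Subset n → Set
IsVerticalCover M F F' =
  IsFlat M F × IsFlat M F' × F ≢ ⊤ × F' ≢ ⊤ × (F ∪ F') ≡ ⊤

Round : ∀ {n} → Matroid n → Set
Round M = ¬ (Σ _ λ F → Σ _ λ F' → IsVerticalCover M F F')

-- Trees with bags: a (finite, nonempty) tree is represented as a rooted
-- rose tree; each node t carries its bag τ(t) ⊆ E(M).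

data DTree (n : ℕ) : Set where
  node : Subset n → List (DTree n) → DTree n

mutual
  bagsT : ∀ {n} → DTree n → Subset n
  bagsT (node b cs) = b ∪ bagsF cs

  bagsF : ∀ {n} → List (DTree n) → Subset n
  bagsF []       = ⊥
  bagsF (c ∷ cs) = bagsT c ∪ bagsF cs

mapBags : ∀ {n} → List (DTree n) → List (Subset n)
mapBags []       = []
mapBags (c ∷ cs) = bagsT c ∷ mapBags cs

unionL : ∀ {n} → List (Subset n) → Subset n
unionL []       = ⊥
unionL (x ∷ xs) = x ∪ unionL xs

IsTreeDecomposition : ∀ {n} → DTree n → Set
IsTreeDecomposition {n} T = ∀ (e : Fin n) → e ∈ bagsT T

-- Node-width of a node t whose bag is b and where F₁,…,F_d are the unions
-- of bags of the components of T − t: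
--   Σ_i r(b ∪ ⋃_{k≠i} F_k) − (d − 1) r(M)
-- sumOthers ls rs: ls = components already passed, rs = remaining ones.
sumOthers : ∀ {n} → Matroid n → Subset n → List (Subset n) → List (Subset n) → ℤ
sumOthers M b ls []       = + 0
sumOthers M b ls (F ∷ rs) =
  + r M (b ∪ (unionL ls ∪ unionL rs)) ℤ.+ sumOthers M b (F ∷ ls) rs

nodeWidth : ∀ {n} → Matroid n → Subset n → List (Subset n) → ℤ
nodeWidth M b Fs =
  sumOthers M b [] Fs ℤ.- ((+ length Fs ℤ.- + 1) ℤ.* + rank M)

maybeCons : ∀ {A : Set} → Maybe A → List A → List A
maybeCons nothing  xs = xs
maybeCons (just x) xs = x ∷ xs

orBot : ∀ {n} → Maybe (Subset n) → Subset n
orBot nothing  = ⊥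
orBot (just X) = X

-- The argument `out` is
-- the union of the bags outside the current subtree (the component of
-- T − t containing the parent of t), or nothing at the root.
-- The components of T − t are: the subtrees of the children of t, and
-- (if t is not the root) the part of T outside the subtree of t.
mutual
  nodeWidths : ∀ {n} → Matroid n → Maybe (Subset n) → DTree n → List ℤ
  nodeWidths M out (node b cs) =
    nodeWidth M b (maybeCons out (mapBags cs)) ∷ childWidths M out b [] cs

  -- ls: bag-unions of children already processed
  childWidths : ∀ {n} → Matroid n → Maybe (Subset n) → Subset n
              → List (Subset n) → List (DTree n) → List ℤ
  childWidths M out b ls []       = []
  childWidths M out b ls (c ∷ rs) =
    nodeWidths M (just (orBot out ∪ (b ∪ (unionL ls ∪ bagsF rs)))) c
    ++ childWidths M out b (bagsT c ∷ ls) rs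

widths : ∀ {n} → Matroid n → DTree n → List ℤ
widths M T = nodeWidths M nothing T

-- tw(M) = k: k is the minimum, over tree-decompositions, of the width
-- (= maximum node-width).
TreeWidthIs : ∀ {n} → Matroid n → ℤ → Set
TreeWidthIs M k =
  (Σ (DTree _) λ T → IsTreeDecomposition T × All (ℤ._≤ k) (widths M T))
  × (∀ T → IsTreeDecomposition T → Any (k ℤ.≤_) (widths M T))

-- A single bag holding every element has node-width r(M), so tw(M) ≤ r(M).
-- Conversely, roundness says that whenever A ∪ B = E(M) one of A, B spans,
-- for otherwise their closures would form a vertical cover. Walk through any
-- tree-decomposition from the root, keeping the invariant that the component
-- of T − t containing the previous node has a spanning complement. At a node t
-- either every set τ(t) ∪ ⋃_{k≠i} F_k spans, and then the node-width is at
-- least d·r(M) − (d − 1)·r(M) = r(M), or one of them does not; then the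
-- component F_i it misses spans, and we move into F_i.
module Submission where

open import Defs
open import Data.Nat as ℕ using (ℕ; _*_)
open import Data.Nat.Properties as ℕ using (_≟_; _≤?_)
open import Data.Integer as ℤ using (ℤ; +_)
import Data.Integer.Properties as ℤ
open import Data.Integer.Tactic.RingSolver using (solve-∀)
open import Data.Fin using (Fin)
open import Data.Fin.Subset using (Subset; _∉_; _⊆_; _∪_; ⁅_⁆; ⊤; ⊥)
open import Data.Fin.Subset.Properties
  using (∈⊤; x∈⁅x⁆; p⊆p∪q; q⊆p∪q; x∈p∪q⁻; x∈p∪q⁺; ⊆⊤; ⊆-antisym;
         ∪-identityˡ; ∪-idempotentCommutativeMonoid)
import Algebra.Solver.IdempotentCommutativeMonoid as ∪-Solver
open import Data.List using (List; []; _∷_; length; allFin)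
open import Data.List.Relation.Unary.All using (All; []; _∷_)
open import Data.List.Relation.Unary.Any using (Any; here; there)
open import Data.List.Relation.Unary.Any.Properties using (++⁺ˡ; ++⁺ʳ)
open import Data.List.Membership.Propositional using () renaming (_∈_ to _∈ₗ_)
open import Data.List.Membership.Propositional.Properties using (∈-allFin)
open import Data.Maybe using (Maybe; just; nothing)
open import Data.Product using (_,_)
open import Data.Sum using (_⊎_; inj₁; inj₂; [_,_])
open import Data.Unit using (tt) renaming (⊤ to Unit)
open import Data.Empty using (⊥-elim)
open import Function using (_∘_)
open import Relation.Binary.PropositionalEquality using (_≡_; _≢_; refl; sym; trans; cong; cong₂; subst)
open import Relation.Nullary using (¬_; yes; no)

∪-mono : ∀ {n} {p p′ q q′ : Subset n} → p ⊆ p′ → q ⊆ q′ → p ∪ q ⊆ p′ ∪ q′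
∪-mono {p = p} {q = q} p⊆p′ q⊆q′ x∈p∪q =
  x∈p∪q⁺ ([ inj₁ ∘ p⊆p′ , inj₂ ∘ q⊆q′ ] (x∈p∪q⁻ p q x∈p∪q))

unionL-mapBags : ∀ {n} (cs : List (DTree n)) → unionL (mapBags cs) ≡ bagsF cs
unionL-mapBags []       = refl
unionL-mapBags (c ∷ cs) = cong (bagsT c ∪_) (unionL-mapBags cs)

-- The bags outside the subtree of the child of t lying between ls and rs:
-- the `out` that childWidths hands to that child.
outside : ∀ {n} → Maybe (Subset n) → Subset n → List (Subset n) → List (DTree n) → Subset n
outside out b ls rs = orBot out ∪ (b ∪ (unionL ls ∪ bagsF rs))

module _ {n : ℕ} where
  open ∪-Solver (∪-idempotentCommutativeMonoid n)

  outside-split : ∀ out b ls (c : DTree n) rs →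
                  outside out b ls (c ∷ rs) ≡ outside out b ls rs ∪ bagsT c
  outside-split out b ls c rs =
    solve 5 (λ o b l c s → o ⊕ (b ⊕ (l ⊕ (c ⊕ s))) ⊜ (o ⊕ (b ⊕ (l ⊕ s))) ⊕ c) refl
      (orBot out) b (unionL ls) (bagsT c) (bagsF rs)

  outside-shift : ∀ out b ls (c : DTree n) rs →
                  outside out b ls (c ∷ rs) ≡ outside out b (bagsT c ∷ ls) rs
  outside-shift out b ls c rs =
    solve 5 (λ o b l c s → o ⊕ (b ⊕ (l ⊕ (c ⊕ s))) ⊜ o ⊕ (b ⊕ ((c ⊕ l) ⊕ s))) refl
      (orBot out) b (unionL ls) (bagsT c) (bagsF rs)

  passed-shift : ∀ out ls ls′ (c : DTree n) → unionL ls′ ≡ orBot out ∪ unionL ls →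
                 unionL (bagsT c ∷ ls′) ≡ orBot out ∪ unionL (bagsT c ∷ ls)
  passed-shift out ls ls′ c passed =
    trans (cong (bagsT c ∪_) passed)
      (solve 3 (λ c o l → c ⊕ (o ⊕ l) ⊜ o ⊕ (c ⊕ l)) refl (bagsT c) (orBot out) (unionL ls))

  complement≡outside : ∀ out b ls ls′ (rs : List (DTree n)) → unionL ls′ ≡ orBot out ∪ unionL ls →
                       b ∪ (unionL ls′ ∪ unionL (mapBags rs)) ≡ outside out b ls rs
  complement≡outside out b ls ls′ rs passed =
    trans (cong₂ (λ X Y → b ∪ (X ∪ Y)) passed (unionL-mapBags rs))
      (solve 4 (λ o b l s → b ⊕ ((o ⊕ l) ⊕ s) ⊜ o ⊕ (b ⊕ (l ⊕ s))) refl
        (orBot out) b (unionL ls) (bagsF rs))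

module Closure {n : ℕ} (M : Matroid n) where

  saturate : Subset n → List (Fin n) → Subset n
  saturate S []       = S
  saturate S (e ∷ es) with r M (S ∪ ⁅ e ⁆) ≟ r M S
  ... | yes _ = saturate (S ∪ ⁅ e ⁆) es
  ... | no  _ = saturate S es

  ⊆-saturate : ∀ S es → S ⊆ saturate S es
  ⊆-saturate S []       x∈S = x∈S
  ⊆-saturate S (e ∷ es) x∈S with r M (S ∪ ⁅ e ⁆) ≟ r M S
  ... | yes _ = ⊆-saturate (S ∪ ⁅ e ⁆) es (p⊆p∪q ⁅ e ⁆ x∈S)
  ... | no  _ = ⊆-saturate S es x∈S

  r-saturate : ∀ S es → r M (saturate S es) ≡ r M S
  r-saturate S []       = refl
  r-saturate S (e ∷ es) with r M (S ∪ ⁅ e ⁆) ≟ r M S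
  ... | yes r≡ = trans (r-saturate (S ∪ ⁅ e ⁆) es) r≡
  ... | no  _  = r-saturate S es

  saturate-closed : ∀ S es e → e ∈ₗ es → e ∉ saturate S es →
                    r M (saturate S es) ℕ.< r M (saturate S es ∪ ⁅ e ⁆)
  saturate-closed S (e′ ∷ es) e e∈ e∉ with r M (S ∪ ⁅ e′ ⁆) ≟ r M S
  saturate-closed S (e ∷ es) e (here refl) e∉ | yes _ =
    ⊥-elim (e∉ (⊆-saturate (S ∪ ⁅ e ⁆) es (q⊆p∪q S ⁅ e ⁆ (x∈⁅x⁆ e))))
  saturate-closed S (e ∷ es) e (here refl) e∉ | no r≢ = begin-strict
    r M (saturate S es)         ≡⟨ r-saturate S es ⟩
    r M S                       <⟨ ℕ.≤∧≢⇒< (r-mono M (p⊆p∪q ⁅ e ⁆)) (r≢ ∘ sym) ⟩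
    r M (S ∪ ⁅ e ⁆)             ≤⟨ r-mono M (∪-mono (⊆-saturate S es) (λ x → x)) ⟩
    r M (saturate S es ∪ ⁅ e ⁆) ∎
    where open ℕ.≤-Reasoning
  saturate-closed S (e′ ∷ es) e (there e∈) e∉ | yes _ =
    saturate-closed (S ∪ ⁅ e′ ⁆) es e e∈ e∉
  saturate-closed S (e′ ∷ es) e (there e∈) e∉ | no _ =
    saturate-closed S es e e∈ e∉

  cl : Subset n → Subset n
  cl S = saturate S (allFin n)

  ⊆-cl : ∀ S → S ⊆ cl S
  ⊆-cl S = ⊆-saturate S (allFin n)

  r-cl : ∀ S → r M (cl S) ≡ r M S
  r-cl S = r-saturate S (allFin n)

  cl-isFlat : ∀ S → IsFlat M (cl S)
  cl-isFlat S e = saturate-closed S (allFin n) e (∈-allFin e)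

module _ {n : ℕ} (M : Matroid n) where
  open Closure M

  Spanning : Subset n → Set
  Spanning X = rank M ℕ.≤ r M X

  cl≢⊤ : ∀ {X} → ¬ Spanning X → cl X ≢ ⊤
  cl≢⊤ {X} ¬spans cl≡⊤ = ¬spans (ℕ.≤-reflexive (trans (cong (r M) (sym cl≡⊤)) (r-cl X)))

  round⇒spanning-side : Round M → ∀ A B → A ∪ B ≡ ⊤ → Spanning A ⊎ Spanning B
  round⇒spanning-side round A B A∪B≡⊤ with rank M ≤? r M A | rank M ≤? r M B
  ... | yes A-spans | _           = inj₁ A-spans
  ... | no  _       | yes B-spans = inj₂ B-spans
  ... | no  ¬A      | no ¬B       = ⊥-elim (round (cl A , cl B ,
      cl-isFlat A , cl-isFlat B , cl≢⊤ ¬A , cl≢⊤ ¬B , cover))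
    where
      cover : cl A ∪ cl B ≡ ⊤
      cover = ⊆-antisym ⊆⊤ (subst (_⊆ cl A ∪ cl B) A∪B≡⊤ (∪-mono (⊆-cl A) (⊆-cl B)))

-- The sets τ(t) ∪ ⋃_{k≠i} F_k whose ranks sumOthers adds up.
componentComplements : ∀ {n} → Subset n → List (Subset n) → List (Subset n) → List (Subset n)
componentComplements b ls []       = []
componentComplements b ls (F ∷ rs) =
  b ∪ (unionL ls ∪ unionL rs) ∷ componentComplements b (F ∷ ls) rs

module _ {n : ℕ} (M : Matroid n) where

  sumOthers-≥ : ∀ {k b ls} rs → All (λ X → k ℕ.≤ r M X) (componentComplements b ls rs) →
                + (length rs * k) ℤ.≤ sumOthers M b ls rs
  sumOthers-≥     []       []           = ℤ.≤-refl
  sumOthers-≥ {k} {b} {ls} (F ∷ rs) (k≤r ∷ k≤rs) =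
    subst (ℤ._≤ sumOthers M b ls (F ∷ rs)) (sym (ℤ.pos-+ k (length rs * k)))
      (ℤ.+-mono-≤ (ℤ.+≤+ k≤r) (sumOthers-≥ rs k≤rs))

  d*R-[d-1]*R≡R : ∀ (d R : ℤ) → d ℤ.* R ℤ.- (d ℤ.- + 1) ℤ.* R ≡ R
  d*R-[d-1]*R≡R = solve-∀

  nodeWidth-≥-rank : ∀ {b} Fs → All (Spanning M) (componentComplements b [] Fs) →
                     + rank M ℤ.≤ nodeWidth M b Fs
  nodeWidth-≥-rank {b} Fs spans = begin
    + R                             ≡⟨ sym (d*R-[d-1]*R≡R (+ d) (+ R)) ⟩
    + d ℤ.* + R ℤ.- [d-1]*R         ≡⟨ cong (ℤ._- [d-1]*R) (sym (ℤ.pos-* d R)) ⟩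
    + (d * R) ℤ.- [d-1]*R           ≤⟨ ℤ.+-monoˡ-≤ (ℤ.- [d-1]*R) (sumOthers-≥ Fs spans) ⟩
    nodeWidth M b Fs                ∎
    where
      open ℤ.≤-Reasoning
      R = rank M
      d = length Fs
      [d-1]*R = (+ d ℤ.- + 1) ℤ.* + R

  isolatedNodeWidth : ∀ b → nodeWidth M b [] ≡ + rank M
  isolatedNodeWidth b = d*R-[d-1]*R≡R (+ 0) (+ rank M)

module Descent {n : ℕ} (M : Matroid n) (round : Round M) where

  ParentTermSpans : Maybe (Subset n) → Subset n → Set
  ParentTermSpans nothing  _ = Unit
  ParentTermSpans (just _) X = Spanning M X

  Wide : List ℤ → Set
  Wide = Any (+ rank M ℤ.≤_)

  passedAtStart : ∀ (out : Maybe (Subset n)) → unionL (maybeCons out []) ≡ orBot out ∪ ⊥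
  passedAtStart nothing  = sym (∪-identityˡ ⊥)
  passedAtStart (just _) = refl

  withParentTerm : ∀ out b cs → ParentTermSpans out (b ∪ bagsF cs) →
                   All (Spanning M) (componentComplements b (maybeCons out []) (mapBags cs)) →
                   All (Spanning M) (componentComplements b [] (maybeCons out (mapBags cs)))
  withParentTerm nothing  b cs _           spans = spans
  withParentTerm (just _) b cs parentSpans spans =
    subst (λ X → Spanning M (b ∪ X)) (sym (trans (∪-identityˡ _) (unionL-mapBags cs))) parentSpans
    ∷ spans

  -- ls′ is ls as it appears in the node-width of t, i.e. preceded by the
  -- parent component when there is one.
  mutual
    descend : ∀ out T → orBot out ∪ bagsT T ≡ ⊤ → ParentTermSpans out (bagsT T) →
              Wide (nodeWidths M out T)
    descend out (node b cs) cover parentSpans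
      with scanChildren out b [] (maybeCons out []) cs (passedAtStart out)
             (subst (λ X → orBot out ∪ (b ∪ X) ≡ ⊤) (sym (∪-identityˡ (bagsF cs))) cover)
    ... | inj₁ wide  = there wide
    ... | inj₂ spans =
      here (nodeWidth-≥-rank M (maybeCons out (mapBags cs)) (withParentTerm out b cs parentSpans spans))

    scanChildren : ∀ out b ls ls′ rs → unionL ls′ ≡ orBot out ∪ unionL ls →
                   outside out b ls rs ≡ ⊤ →
                   Wide (childWidths M out b ls rs)
                   ⊎ All (Spanning M) (componentComplements b ls′ (mapBags rs))
    scanChildren out b ls ls′ []       _      _     = inj₂ []
    scanChildren out b ls ls′ (c ∷ rs) passed cover
      with round⇒spanning-side M round (outside out b ls rs) (bagsT c)
             (trans (sym (outside-split out b ls c rs)) cover)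
    ... | inj₂ c-spans =
      inj₁ (++⁺ˡ (descend (just (outside out b ls rs)) c
                    (trans (sym (outside-split out b ls c rs)) cover) c-spans))
    ... | inj₁ outside-spans
      with scanChildren out b (bagsT c ∷ ls) (bagsT c ∷ ls′) rs
             (passed-shift out ls ls′ c passed) (trans (sym (outside-shift out b ls c rs)) cover)
    ...   | inj₁ wide  = inj₁ (++⁺ʳ _ wide)
    ...   | inj₂ spans =
      inj₂ (subst (Spanning M) (sym (complement≡outside out b ls ls′ rs passed)) outside-spans ∷ spans)

  round⇒wide-node : ∀ T → IsTreeDecomposition T → Wide (widths M T)
  round⇒wide-node T covers =
    descend nothing T (trans (∪-identityˡ (bagsT T)) (⊆-antisym ⊆⊤ (λ {x} _ → covers x))) tt

mainTheorem15 : ∀ {n : ℕ} (M : Matroid n) → Round M → TreeWidthIs M (+ rank M)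
mainTheorem15 M round =
  (node ⊤ [] , (λ e → p⊆p∪q ⊥ ∈⊤) , ℤ.≤-reflexive (isolatedNodeWidth M ⊤) ∷ [])
  , Descent.round⇒wide-node M round
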